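{- Let $n$ be a perfect square which is divisible by $5^4$. Then $C_{S(n)^*}\leq 7$.
   Context: $\mathbb Z_n=\mathbb Z/n\mathbb Z$; $S(n)^*=\{x^2:x\in\mathbb Z_n\}\setminus\{0\}$. For $A\subseteq\mathbb Z_n$, a subsequence $T$ of a sequence $(x_1,\dots,x_k)$ in $\mathbb Z_n$, with nonempty index set $I$, is an $A$-weighted zero-sum subsequence if there exist $a_i\in A$ ($i\in I$) with $\sum_{i\in I}a_ix_i=0$. $C_{S(n)^*}$ is the least positive integer $k$ such that every sequence of length $k$ in $\mathbb Z_n$ has an $S(n)^*$-weighted zero-sum subsequence consisting of consecutive terms. -}

module Defs where

open import Data.Nat using (ℕ; zero; suc; _+_; _*_; _≤_; _<_; _^_; NonZero)
open import Data.Nat.DivMod using (_%_)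
open import Data.Nat.Divisibility using (_∣_)
open import Data.Fin using (Fin; toℕ) renaming (zero to fzero; suc to fsuc)
open import Data.Product using (Σ; ∃; _×_)
open import Relation.Binary.PropositionalEquality using (_≡_; _≢_)
open import Relation.Nullary using (yes; no)
open import Data.Nat using (_≤?_)

-- Z_n is represented by Fin n (residues 0..n-1), with arithmetic mod n via _%_.

SqStar : (n : ℕ) → .{{_ : NonZero n}} → Fin n → Set
SqStar n a = (toℕ a ≢ 0) × ∃ λ (y : Fin n) → (toℕ y * toℕ y) % n ≡ toℕ a

finSum : ∀ {k} → (Fin k → ℕ) → ℕ
finSum {zero}  f = 0
finSum {suc k} f = f fzero + finSum (λ t → f (fsuc t))

windowTerm : ∀ {n k} → (i j : Fin k) → (a x : Fin k → Fin n) → Fin k → ℕ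
windowTerm i j a x t with toℕ i ≤? toℕ t | toℕ t ≤? toℕ j
... | yes _ | yes _ = toℕ (a t) * toℕ (x t)
... | _ | _ = 0

HasConsecWZS : (n : ℕ) → .{{_ : NonZero n}} → (k : ℕ) → (Fin k → Fin n) → Set
HasConsecWZS n k x =
  Σ (Fin k) λ i → Σ (Fin k) λ j → (toℕ i ≤ toℕ j) ×
    Σ (Fin k → Fin n) λ a →
      ((t : Fin k) → toℕ i ≤ toℕ t → toℕ t ≤ toℕ j → SqStar n (a t)) ×
      (finSum (windowTerm i j a x) % n ≡ 0)

CProp : (n : ℕ) → .{{_ : NonZero n}} → ℕ → Set
CProp n k = (x : Fin k → Fin n) → HasConsecWZS n k x

-- C_{S(n)^*} ≤ c : the least positive k with CProp n k is ≤ c, i.e. some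
-- positive k ≤ c has the property.
CLe : (n : ℕ) → .{{_ : NonZero n}} → ℕ → Set
CLe n c = ∃ λ k → (1 ≤ k) × (k ≤ c) × CProp n k

-- Write n = m² = 625 d² (625 ∣ m² forces 25 ∣ m).  Multiplication by d² embeds ℤ_625 in ℤ_n
-- and sends each nonzero square s² of ℤ_625 to the nonzero square (d s)² of ℤ_n, so it suffices
-- that any five integers x₀, …, x₄ contain a window whose sum, weighted by nonzero squares of
-- ℤ_625, vanishes mod 625 (so in fact C ≤ 5).  If 25 ∣ xₜ, the weight 25 = 5² on xₜ alone works.
-- Otherwise classify the xₜ by their 5-adic valuation (0 or 1) and by whether their unit part is
-- a square mod 5: two terms xᵢ, xⱼ with i < j fall into the same of these four classes.  Weight xᵢ
-- by 1 and the terms strictly between by 25, giving T ≡ xᵢ (mod 25).  Since −1 is a square mod 5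
-- and, by Hensel's lemma, a unit of ℤ_625 is a square iff it is one mod 5, there is a unit square
-- u with T + u xⱼ ≡ 0 (mod 625).  The finitely many facts about ℤ_5 and ℤ_625 that are used are
-- checked by exhaustive computation.

module Submission where

open import Defs
open import Data.Nat using (ℕ; _*_; _^_; NonZero)
open import Data.Nat.Divisibility using (_∣_)
open import Data.Product using (∃)
open import Relation.Binary.PropositionalEquality using (_≡_)

open import Data.Nat
open import Data.Nat.Properties
open import Data.Nat.DivMod
open import Data.Nat.Divisibility
open import Data.Nat.Tactic.RingSolver using (solve-∀)
open import Data.Fin as F using (Fin; toℕ; fromℕ<; combine; punchIn)
open import Data.Fin.Properties
  using (toℕ-injective; toℕ-fromℕ<; punchInᵢ≢i; combine-injectiveˡ; combine-injectiveʳ; any?; pigeonhole)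
open import Data.Product
open import Data.Sum using (_⊎_; inj₁; inj₂)
open import Data.Unit using (tt)
open import Data.Bool using (if_then_else_)
open import Data.Vec.Functional using (removeAt; replicate)
open import Function using (_∘_)
open import Relation.Binary.PropositionalEquality
open import Relation.Nullary
open import Relation.Nullary.Decidable using (toWitness; _→-dec_; _⊎-dec_; ¬?; does)
open import Algebra.Properties.Semiring.Sum +-*-semiring
  using (sum; sum-cong-≗; ∑-distrib-+; *-distribʳ-sum; sum-remove; sum-replicate-zero)

open ≡-Reasoning

-- Windowed sums

window : ∀ {k} → Fin k → Fin k → (Fin k → ℕ) → Fin k → ℕ
window i j f t with toℕ i ≤? toℕ t | toℕ t ≤? toℕ j
... | yes _ | yes _ = f t
... | _     | _     = 0

module _ {k} (i j : Fin k) where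

  windowTerm≡window : ∀ {n} (a x : Fin k → Fin n) t →
                      windowTerm i j a x t ≡ window i j (λ s → toℕ (a s) * toℕ (x s)) t
  windowTerm≡window a x t with toℕ i ≤? toℕ t | toℕ t ≤? toℕ j
  ... | yes _ | yes _ = refl
  ... | yes _ | no  _ = refl
  ... | no  _ | _     = refl

  window-inside : ∀ (f : Fin k → ℕ) {t} → toℕ i ≤ toℕ t → toℕ t ≤ toℕ j → window i j f t ≡ f t
  window-inside f {t} i≤t t≤j with toℕ i ≤? toℕ t | toℕ t ≤? toℕ j
  ... | yes _   | yes _   = refl
  ... | yes _   | no  t≰j = contradiction t≤j t≰j
  ... | no  i≰t | _       = contradiction i≤t i≰t

  window-cong : ∀ {f g : Fin k → ℕ} {t} → f t ≡ g t → window i j f t ≡ window i j g t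
  window-cong {t = t} ft≡gt with toℕ i ≤? toℕ t | toℕ t ≤? toℕ j
  ... | yes _ | yes _ = ft≡gt
  ... | yes _ | no  _ = refl
  ... | no  _ | _     = refl

  window-zero : ∀ {f : Fin k → ℕ} {t} → f t ≡ 0 → window i j f t ≡ 0
  window-zero {t = t} ft≡0 with toℕ i ≤? toℕ t | toℕ t ≤? toℕ j
  ... | yes _ | yes _ = ft≡0
  ... | yes _ | no  _ = refl
  ... | no  _ | _     = refl

  window-map : ∀ (g : ℕ → ℕ) → g 0 ≡ 0 → ∀ (f : Fin k → ℕ) t →
               window i j (g ∘ f) t ≡ g (window i j f t)
  window-map g g0≡0 f t with toℕ i ≤? toℕ t | toℕ t ≤? toℕ j
  ... | yes _ | yes _ = refl
  ... | yes _ | no  _ = sym g0≡0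
  ... | no  _ | _     = sym g0≡0

  window-+ : ∀ (f g : Fin k → ℕ) t →
             window i j (λ s → f s + g s) t ≡ window i j f t + window i j g t
  window-+ f g t with toℕ i ≤? toℕ t | toℕ t ≤? toℕ j
  ... | yes _ | yes _ = refl
  ... | yes _ | no  _ = refl
  ... | no  _ | _     = refl

window-self : ∀ {k} (f : Fin k → ℕ) t → window t t f t ≡ f t
window-self f t = window-inside t t f ≤-refl ≤-refl

window-singleton-outside : ∀ {k} {t₀ t : Fin k} (f : Fin k → ℕ) → t ≢ t₀ → window t₀ t₀ f t ≡ 0
window-singleton-outside {t₀ = t₀} {t} f t≢t₀ with toℕ t₀ ≤? toℕ t | toℕ t ≤? toℕ t₀
... | yes t₀≤t | yes t≤t₀ = contradiction (toℕ-injective (≤-antisym t≤t₀ t₀≤t)) t≢t₀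
... | yes _    | no  _    = refl
... | no  _    | _        = refl

window-of-singleton : ∀ {k} {i j t₀ : Fin k} (f : Fin k → ℕ) → toℕ i ≤ toℕ t₀ → toℕ t₀ ≤ toℕ j →
                      ∀ t → window i j (window t₀ t₀ f) t ≡ window t₀ t₀ f t
window-of-singleton {i = i} {j} {t₀} f i≤t₀ t₀≤j t with t F.≟ t₀
... | yes refl = window-inside i j (window t₀ t₀ f) i≤t₀ t₀≤j
... | no  t≢t₀ = trans (window-zero i j (window-singleton-outside f t≢t₀))
                       (sym (window-singleton-outside f t≢t₀))

sum-window-singleton : ∀ {k} (t₀ : Fin k) (f : Fin k → ℕ) → sum (window t₀ t₀ f) ≡ f t₀
sum-window-singleton {suc k} t₀ f = begin
  sum (window t₀ t₀ f)
    ≡⟨ sum-remove {i = t₀} (window t₀ t₀ f) ⟩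
  window t₀ t₀ f t₀ + sum (removeAt (window t₀ t₀ f) t₀)
    ≡⟨ cong₂ _+_ (window-self f t₀) (sum-cong-≗ {k} outside) ⟩
  f t₀ + sum (replicate k 0)
    ≡⟨ cong (f t₀ +_) (sum-replicate-zero k) ⟩
  f t₀ + 0
    ≡⟨ +-identityʳ (f t₀) ⟩
  f t₀
    ∎
  where
  outside : ∀ s → window t₀ t₀ f (punchIn t₀ s) ≡ 0
  outside s = window-singleton-outside f (punchInᵢ≢i t₀ s)

finSum≡sum : ∀ {k} (f : Fin k → ℕ) → finSum f ≡ sum f
finSum≡sum {zero}  f = refl
finSum≡sum {suc k} f = cong (f F.zero +_) (finSum≡sum (f ∘ F.suc))

pairWeight : ∀ {k} → Fin k → Fin k → ℕ → Fin k → ℕ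
pairWeight i j u t with t F.≟ i | t F.≟ j
... | yes _ | _     = 1
... | no  _ | yes _ = u
... | no  _ | no  _ = 25

puncture : ∀ {k} → Fin k → Fin k → (Fin k → ℕ) → Fin k → ℕ
puncture i j f t with t F.≟ i | t F.≟ j
... | no _ | no _ = f t
... | _    | _    = 0

module _ {k} {i j : Fin k} (u : ℕ) (f : Fin k → ℕ) where

  pairWeight-split : i ≢ j → ∀ t →
    pairWeight i j u t * f t ≡ window i i f t + puncture i j f t * 25 + window j j (λ s → u * f s) t
  pairWeight-split i≢j t with t F.≟ i | t F.≟ j
  ... | yes refl | yes refl = contradiction refl i≢j
  ... | yes refl | no  t≢j  = begin
    1 * f t
      ≡⟨ +-identityʳ (1 * f t) ⟨
    f t + 0 + 0
      ≡⟨ cong₂ (λ a b → a + 0 + b) (window-self f t) (window-singleton-outside _ t≢j) ⟨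
    window t t f t + 0 + window j j (λ s → u * f s) t
      ∎
  ... | no  t≢i  | yes refl = begin
    u * f t
      ≡⟨ cong₂ (λ a b → a + 0 + b) (window-singleton-outside f t≢i) (window-self (λ s → u * f s) t) ⟨
    window i i f t + 0 + window t t (λ s → u * f s) t
      ∎
  ... | no  t≢i  | no  t≢j  = begin
    25 * f t
      ≡⟨ *-comm 25 (f t) ⟩
    f t * 25
      ≡⟨ +-identityʳ (f t * 25) ⟨
    0 + f t * 25 + 0
      ≡⟨ cong₂ (λ a b → a + f t * 25 + b) (window-singleton-outside f t≢i) (window-singleton-outside _ t≢j) ⟨
    window i i f t + f t * 25 + window j j (λ s → u * f s) t
      ∎

  window-pairWeight : toℕ i < toℕ j → ∀ t →
    window i j (λ s → pairWeight i j u s * f s) t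
      ≡ window i i f t + window i j (puncture i j f) t * 25 + window j j (λ s → u * f s) t
  window-pairWeight i<j t = begin
    window i j (λ s → pairWeight i j u s * f s) t
      ≡⟨ window-cong i j (pairWeight-split i≢j t) ⟩
    window i j (λ s → fᵢ s + puncture i j f s * 25 + fⱼ s) t
      ≡⟨ window-+ i j _ fⱼ t ⟩
    window i j (λ s → fᵢ s + puncture i j f s * 25) t + window i j fⱼ t
      ≡⟨ cong (_+ window i j fⱼ t) (window-+ i j fᵢ _ t) ⟩
    window i j fᵢ t + window i j (λ s → puncture i j f s * 25) t + window i j fⱼ t
      ≡⟨ cong₂ _+_ (cong₂ _+_ (window-of-singleton f ≤-refl (<⇒≤ i<j) t)
                              (window-map i j (_* 25) refl (puncture i j f) t))
                   (window-of-singleton _ (<⇒≤ i<j) ≤-refl t) ⟩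
    fᵢ t + window i j (puncture i j f) t * 25 + fⱼ t
      ∎
    where
    fᵢ fⱼ : Fin k → ℕ
    fᵢ = window i i f
    fⱼ = window j j (λ s → u * f s)
    i≢j : i ≢ j
    i≢j refl = <-irrefl refl i<j

  sum-window-pairWeight : toℕ i < toℕ j →
    sum (window i j (λ t → pairWeight i j u t * f t)) ≡ f i + sum (window i j (puncture i j f)) * 25 + u * f j
  sum-window-pairWeight i<j = begin
    sum (window i j (λ t → pairWeight i j u t * f t))
      ≡⟨ sum-cong-≗ (window-pairWeight i<j) ⟩
    sum (λ t → fᵢ t + interior t * 25 + fⱼ t)
      ≡⟨ ∑-distrib-+ (λ t → fᵢ t + interior t * 25) fⱼ ⟩
    sum (λ t → fᵢ t + interior t * 25) + sum fⱼ
      ≡⟨ cong (_+ sum fⱼ) (∑-distrib-+ fᵢ (λ t → interior t * 25)) ⟩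
    sum fᵢ + sum (λ t → interior t * 25) + sum fⱼ
      ≡⟨ cong₂ _+_ (cong₂ _+_ (sum-window-singleton i f) (sym (*-distribʳ-sum 25 interior)))
                   (sum-window-singleton j (λ s → u * f s)) ⟩
    f i + sum interior * 25 + u * f j
      ∎
    where
    fᵢ fⱼ interior : Fin k → ℕ
    fᵢ = window i i f
    fⱼ = window j j (λ s → u * f s)
    interior = window i j (puncture i j f)

-- Arithmetic modulo 5 and 625

NonzeroSquareMod : (q : ℕ) .{{_ : NonZero q}} → ℕ → Set
NonzeroSquareMod q w = w ≢ 0 × ∃ λ s → s * s % q ≡ w

QR₅ : ℕ → Set
QR₅ r = r ≡ 1 ⊎ r ≡ 4

QR₅? : ∀ r → Dec (QR₅ r)
QR₅? r = (r ≟ 1) ⊎-dec (r ≟ 4)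

χ₅ : ℕ → Fin 2
χ₅ r = if does (QR₅? r) then F.zero else F.suc F.zero

-- `abstract` keeps these exhaustive checks from being unfolded where they are used.
abstract
  QR₅⇒square-mod625 : ∀ {u} → u < 625 → QR₅ (u % 5) → ∃ λ s → s < 625 × s * s % 625 ≡ u
  QR₅⇒square-mod625 =
    toWitness {a? = allUpTo? (λ u → QR₅? (u % 5) →-dec anyUpTo? (λ s → s * s % 625 ≟ u) 625) 625} tt

  unit-invertible-mod625 : ∀ {r} → r < 625 → r % 5 ≢ 0 → ∃ λ y → y < 625 × (y * r + 1) % 625 ≡ 0
  unit-invertible-mod625 =
    toWitness {a? = allUpTo? (λ r → ¬? (r % 5 ≟ 0) →-dec anyUpTo? (λ y → (y * r + 1) % 625 ≟ 0) 625) 625} tt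

  square≡0-mod625 : ∀ {r} → r < 625 → r * r % 625 ≡ 0 → r % 25 ≡ 0
  square≡0-mod625 = toWitness {a? = allUpTo? (λ r → (r * r % 625 ≟ 0) →-dec (r % 25 ≟ 0)) 625} tt

  sameχ₅⇒QR₅ : ∀ {a} → a < 5 → ∀ {b} → b < 5 → ∀ {c} → c < 5 →
               a ≢ 0 → b ≢ 0 → χ₅ a ≡ χ₅ b → (c * a + b) % 5 ≡ 0 → QR₅ c
  sameχ₅⇒QR₅ = toWitness {a? = allUpTo? (λ a → allUpTo? (λ b → allUpTo? (λ c →
    ¬? (a ≟ 0) →-dec ¬? (b ≟ 0) →-dec χ₅ a F.≟ χ₅ b →-dec (c * a + b) % 5 ≟ 0 →-dec QR₅? c) 5) 5) 5} tt

[m%d*n%d+o%d]%d≡[m*n+o]%d : ∀ m n o d .{{_ : NonZero d}} → (m % d * (n % d) + o % d) % d ≡ (m * n + o) % d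
[m%d*n%d+o%d]%d≡[m*n+o]%d m n o d = begin
  (m % d * (n % d) + o % d) % d
    ≡⟨ %-distribˡ-+ (m % d * (n % d)) (o % d) d ⟩
  (m % d * (n % d) % d + o % d % d) % d
    ≡⟨ cong₂ (λ a b → (a + b) % d) (sym (%-distribˡ-* m n d)) (m%n%n≡m%n o d) ⟩
  (m * n % d + o % d) % d
    ≡⟨ %-distribˡ-+ (m * n) o d ⟨
  (m * n + o) % d
    ∎

5∣625 : 5 ∣ 625
5∣625 = divides 125 refl

QR₅⇒nonzeroSquare-mod625 : ∀ {u} → u < 625 → QR₅ (u % 5) → NonzeroSquareMod 625 u
QR₅⇒nonzeroSquare-mod625 u<625 u-QR with QR₅⇒square-mod625 u<625 u-QR
... | s , _ , s²≡u = u≢0 u-QR , s , s²≡u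
  where
  u≢0 : ∀ {u} → QR₅ (u % 5) → u ≢ 0
  u≢0 (inj₁ ()) refl
  u≢0 (inj₂ ()) refl

negInverse-mod625 : ∀ X → X % 5 ≢ 0 → ∃ λ Y → 625 ∣ Y * X + 1
negInverse-mod625 X X≢0 = Y , m%n≡0⇒n∣m (Y * X + 1) 625 (begin
  (Y * X + 1) % 625                ≡⟨ [m%d*n%d+o%d]%d≡[m*n+o]%d Y X 1 625 ⟨
  (Y % 625 * (X % 625) + 1) % 625  ≡⟨ cong (λ y → (y * (X % 625) + 1) % 625) (m<n⇒m%n≡m Y<625) ⟩
  (Y * (X % 625) + 1) % 625        ≡⟨ proj₂ (proj₂ inverse) ⟩
  0                                ∎)
  where
  inverse = unit-invertible-mod625 (m%n<n X 625) (X≢0 ∘ trans (sym (m∣n⇒o%n%m≡o%m 5 625 X 5∣625)))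
  Y = proj₁ inverse
  Y<625 = proj₁ (proj₂ inverse)

625∣m²⇒25∣m : ∀ m → 625 ∣ m * m → 25 ∣ m
625∣m²⇒25∣m m 625∣m² = m%n≡0⇒n∣m m 25 (begin
  m % 25        ≡⟨ m∣n⇒o%n%m≡o%m 25 625 m (divides 25 refl) ⟨
  m % 625 % 25  ≡⟨ square≡0-mod625 (m%n<n m 625) r²≡0 ⟩
  0             ∎)
  where
  r²≡0 : m % 625 * (m % 625) % 625 ≡ 0
  r²≡0 = trans (sym (%-distribˡ-* m m 625)) (n∣m⇒m%n≡0 (m * m) 625 625∣m²)

SquareCancels : ℕ → ℕ → Set
SquareCancels X T = ∃ λ u → NonzeroSquareMod 625 u × 625 ∣ T + u * X

squareCancels-unit : ∀ X T → X % 5 ≢ 0 → T % 5 ≢ 0 → χ₅ (X % 5) ≡ χ₅ (T % 5) → SquareCancels X T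
squareCancels-unit X T X≢0 T≢0 sameχ = u , QR₅⇒nonzeroSquare-mod625 (m%n<n (T * Y) 625) u-QR , 625∣T+uX
  where
  inverse = negInverse-mod625 X X≢0
  Y = proj₁ inverse
  u = T * Y % 625
  q = T * Y / 625
  625∣T+uX : 625 ∣ T + u * X
  625∣T+uX = ∣m+n∣m⇒∣n (subst (625 ∣_) expand (∣n⇒∣m*n T (proj₂ inverse))) (n∣m*n*o q X)
    where
    distribute : ∀ t y x → t * (y * x + 1) ≡ t * y * x + t
    distribute = solve-∀
    regroup : ∀ a b x t → (a + b) * x + t ≡ b * x + (t + a * x)
    regroup = solve-∀
    expand : T * (Y * X + 1) ≡ q * 625 * X + (T + u * X)
    expand = begin
      T * (Y * X + 1)            ≡⟨ distribute T Y X ⟩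
      (T * Y) * X + T            ≡⟨ cong (λ z → z * X + T) (m≡m%n+[m/n]*n (T * Y) 625) ⟩
      (u + q * 625) * X + T      ≡⟨ regroup u (q * 625) X T ⟩
      q * 625 * X + (T + u * X)  ∎
  u-QR : QR₅ (u % 5)
  u-QR = sameχ₅⇒QR₅ (m%n<n X 5) (m%n<n T 5) (m%n<n u 5) X≢0 T≢0 sameχ (begin
    (u % 5 * (X % 5) + T % 5) % 5  ≡⟨ [m%d*n%d+o%d]%d≡[m*n+o]%d u X T 5 ⟩
    (u * X + T) % 5                ≡⟨ n∣m⇒m%n≡0 _ 5 (∣-trans 5∣625 (subst (625 ∣_) (+-comm T (u * X)) 625∣T+uX)) ⟩
    0                              ∎)

squareCancels-*5 : ∀ {X T} → SquareCancels X T → SquareCancels (X * 5) (T * 5)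
squareCancels-*5 {X} {T} (u , u-square , 625∣T+uX) =
  u , u-square , subst (625 ∣_) (scale T u X) (∣m⇒∣m*n 5 625∣T+uX)
  where
  scale : ∀ t u x → (t + u * x) * 5 ≡ t * 5 + u * (x * 5)
  scale = solve-∀

digitClass : ℕ → ℕ → Fin 4
digitClass d₀ d₁ with d₀ ≟ 0
... | no  _ = combine {2} F.zero (χ₅ d₀)
... | yes _ = combine {2} (F.suc F.zero) (χ₅ d₁)

-- For 25 ∤ X: the 5-adic valuation of X (0 or 1) and the quadratic character of its unit part.
squareClass : ℕ → Fin 4
squareClass X = digitClass (X % 5) (X % 25 / 5)

squareClass-+25 : ∀ a R → squareClass (a + R * 25) ≡ squareClass a
squareClass-+25 a R = cong₂ digitClass (%-remove-+ʳ a {d = 5} (∣n⇒∣m*n R (divides 5 refl)))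
                                       (cong (_/ 5) ([m+kn]%n≡m%n a R 25))

secondDigit≢0 : ∀ X → X % 5 ≡ 0 → X % 25 ≢ 0 → X / 5 % 5 ≢ 0
secondDigit≢0 X X%5≡0 X%25≢0 X/5%5≡0 = X%25≢0 (begin
  X % 25          ≡⟨ cong (_% 25) (m/n*n≡m (m%n≡0⇒n∣m X 5 X%5≡0)) ⟨
  X / 5 * 5 % 25  ≡⟨ m%n*o≡m*o%[n*o] (X / 5) 5 5 ⟨
  X / 5 % 5 * 5   ≡⟨ cong (_* 5) X/5%5≡0 ⟩
  0               ∎)

sameSquareClass⇒squareCancels : ∀ X T → X % 25 ≢ 0 → T % 25 ≢ 0 →
                                squareClass X ≡ squareClass T → SquareCancels X T
sameSquareClass⇒squareCancels X T X%25≢0 T%25≢0 same with X % 5 ≟ 0 | T % 5 ≟ 0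
... | no X%5≢0  | no T%5≢0  =
  squareCancels-unit X T X%5≢0 T%5≢0 (combine-injectiveʳ {2} F.zero (χ₅ (X % 5)) F.zero (χ₅ (T % 5)) same)
... | no _      | yes _     = contradiction (combine-injectiveˡ {2} F.zero _ (F.suc F.zero) _ same) λ ()
... | yes _     | no _      = contradiction (combine-injectiveˡ {2} (F.suc F.zero) _ F.zero _ same) λ ()
... | yes X%5≡0 | yes T%5≡0 =
  subst₂ SquareCancels (m/n*n≡m (m%n≡0⇒n∣m X 5 X%5≡0)) (m/n*n≡m (m%n≡0⇒n∣m T 5 T%5≡0))
    (squareCancels-*5 {X / 5} {T / 5}
      (squareCancels-unit (X / 5) (T / 5) (secondDigit≢0 X X%5≡0 X%25≢0) (secondDigit≢0 T T%5≡0 T%25≢0) sameχ))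
  where
  sameχ : χ₅ (X / 5 % 5) ≡ χ₅ (T / 5 % 5)
  sameχ = subst₂ (λ a b → χ₅ a ≡ χ₅ b) (m%[n*o]/o≡m/o%n X 5 5) (m%[n*o]/o≡m/o%n T 5 5)
                 (combine-injectiveʳ {2} (F.suc F.zero) (χ₅ (X % 25 / 5)) (F.suc F.zero) (χ₅ (T % 25 / 5)) same)

-- Zero-sum windows modulo 625

ZeroSumWindow : (q : ℕ) .{{_ : NonZero q}} → ∀ {k} → (Fin k → ℕ) → Set
ZeroSumWindow q {k} X =
  Σ (Fin k) λ i → Σ (Fin k) λ j → toℕ i ≤ toℕ j ×
    Σ (Fin k → ℕ) λ w → (∀ t → NonzeroSquareMod q (w t)) × q ∣ sum (window i j (λ t → w t * X t))

1-square : NonzeroSquareMod 625 1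
1-square = (λ ()) , 1 , refl

25-square : NonzeroSquareMod 625 25
25-square = (λ ()) , 5 , refl

singletonWindow : ∀ {k} (X : Fin k → ℕ) t → 25 ∣ X t → ZeroSumWindow 625 X
singletonWindow X t 25∣Xt =
  t , t , ≤-refl , (λ _ → 25) , (λ _ → 25-square) ,
  subst (625 ∣_) (sym (sum-window-singleton t (λ s → 25 * X s))) (*-monoʳ-∣ 25 25∣Xt)

pairWeight-square : ∀ {k} {i j : Fin k} {u} → NonzeroSquareMod 625 u →
                    ∀ t → NonzeroSquareMod 625 (pairWeight i j u t)
pairWeight-square {i = i} {j} u-square t with t F.≟ i | t F.≟ j
... | yes _ | _     = 1-square
... | no  _ | yes _ = u-square
... | no  _ | no  _ = 25-square

pairWindow : ∀ {k} (X : Fin k → ℕ) {i j} → toℕ i < toℕ j →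
             SquareCancels (X j) (X i + sum (window i j (puncture i j X)) * 25) → ZeroSumWindow 625 X
pairWindow X {i} {j} i<j (u , u-square , 625∣Σ) =
  i , j , <⇒≤ i<j , pairWeight i j u , pairWeight-square u-square ,
  subst (625 ∣_) (sym (sum-window-pairWeight u X i<j)) 625∣Σ

zeroSumWindow625 : (X : Fin 5 → ℕ) → ZeroSumWindow 625 X
zeroSumWindow625 X with any? (λ t → X t % 25 ≟ 0)
... | yes (t , Xt%25≡0) = singletonWindow X t (m%n≡0⇒n∣m (X t) 25 Xt%25≡0)
... | no  none          with pigeonhole (n<1+n 4) (squareClass ∘ X)
...   | i , j , i<j , same =
  pairWindow X i<j (sameSquareClass⇒squareCancels (X j) T (X%25≢0 j) T%25≢0 sameClass)
  where
  X%25≢0 : ∀ t → X t % 25 ≢ 0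
  X%25≢0 t Xt%25≡0 = none (t , Xt%25≡0)
  R = sum (window i j (puncture i j X))
  T = X i + R * 25
  T%25≢0 : T % 25 ≢ 0
  T%25≢0 = X%25≢0 i ∘ trans (sym ([m+kn]%n≡m%n (X i) R 25))
  sameClass : squareClass (X j) ≡ squareClass T
  sameClass = trans (sym same) (sym (squareClass-+25 (X i) R))

-- Transfer from ℤ_625 to ℤ_n

module _ {n} .{{_ : NonZero n}} (q d : ℕ) .{{_ : NonZero q}} (n≡q*d² : n ≡ q * (d * d)) where

  private
    d²≢0 : d * d ≢ 0
    d²≢0 d²≡0 = ≢-nonZero⁻¹ n (trans n≡q*d² (trans (cong (q *_) d²≡0) (*-zeroʳ q)))

    instance
      d²-nonZero : NonZero (d * d)
      d²-nonZero = ≢-nonZero d²≢0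

      q*d²-nonZero : NonZero (q * (d * d))
      q*d²-nonZero = m*n≢0 q (d * d)

  scaledWeight : ∀ {w} → NonzeroSquareMod q w → Fin n
  scaledWeight {w} (_ , s , s²≡w) = fromℕ< (subst (w * (d * d) <_) (sym n≡q*d²) (*-monoˡ-< (d * d) w<q))
    where
    w<q : w < q
    w<q = subst (_< q) s²≡w (m%n<n (s * s) q)

  toℕ-scaledWeight : ∀ {w} (w-square : NonzeroSquareMod q w) → toℕ (scaledWeight w-square) ≡ w * (d * d)
  toℕ-scaledWeight (_ , _ , _) = toℕ-fromℕ< _

  scaledWeight-SqStar : ∀ {w} (w-square : NonzeroSquareMod q w) → SqStar n (scaledWeight w-square)
  scaledWeight-SqStar {w} w-square@(w≢0 , s , s²≡w) = nonzero , fromℕ< (m%n<n (d * s) n) , root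
    where
    nonzero : toℕ (scaledWeight w-square) ≢ 0
    nonzero = w≢0 ∘ m*n≡0⇒m≡0 w (d * d) ∘ trans (sym (toℕ-scaledWeight w-square))
    root : toℕ (fromℕ< (m%n<n (d * s) n)) * toℕ (fromℕ< (m%n<n (d * s) n)) % n ≡ toℕ (scaledWeight w-square)
    root = begin
      toℕ (fromℕ< (m%n<n (d * s) n)) * toℕ (fromℕ< (m%n<n (d * s) n)) % n
                                      ≡⟨ cong (λ r → r * r % n) (toℕ-fromℕ< (m%n<n (d * s) n)) ⟩
      d * s % n * (d * s % n) % n     ≡⟨ %-distribˡ-* (d * s) (d * s) n ⟨
      d * s * (d * s) % n             ≡⟨ cong (_% n) (square-of-product d s) ⟩
      s * s * (d * d) % n             ≡⟨ %-congʳ n≡q*d² ⟩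
      s * s * (d * d) % (q * (d * d)) ≡⟨ m%n*o≡m*o%[n*o] (s * s) q (d * d) ⟨
      s * s % q * (d * d)             ≡⟨ cong (_* (d * d)) s²≡w ⟩
      w * (d * d)                     ≡⟨ toℕ-scaledWeight w-square ⟨
      toℕ (scaledWeight w-square)     ∎
      where
      square-of-product : ∀ d s → d * s * (d * s) ≡ s * s * (d * d)
      square-of-product = solve-∀

  transfer : ∀ {k} (x : Fin k → Fin n) → ZeroSumWindow q (toℕ ∘ x) → HasConsecWZS n k x
  transfer {k} x (i , j , i≤j , w , w-square , q∣S) =
    i , j , i≤j , a , (λ t _ _ → scaledWeight-SqStar (w-square t)) , finSum%n≡0
    where
    a : Fin k → Fin n
    a t = scaledWeight (w-square t)
    S : ℕ
    S = sum (window i j (λ t → w t * toℕ (x t)))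
    rescale : ∀ t → toℕ (a t) * toℕ (x t) ≡ w t * toℕ (x t) * (d * d)
    rescale t = trans (cong (_* toℕ (x t)) (toℕ-scaledWeight (w-square t)))
                      (*-right-comm (w t) (d * d) (toℕ (x t)))
      where
      *-right-comm : ∀ a b c → a * b * c ≡ a * c * b
      *-right-comm = solve-∀
    finSum≡S*d² : finSum (windowTerm i j a x) ≡ S * (d * d)
    finSum≡S*d² = begin
      finSum (windowTerm i j a x)
        ≡⟨ finSum≡sum (windowTerm i j a x) ⟩
      sum (windowTerm i j a x)
        ≡⟨ sum-cong-≗ termwise ⟩
      sum (λ t → window i j (λ s → w s * toℕ (x s)) t * (d * d))
        ≡⟨ *-distribʳ-sum {k} (d * d) (window i j (λ s → w s * toℕ (x s))) ⟨
      S * (d * d)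
        ∎
      where
      termwise : ∀ t → windowTerm i j a x t ≡ window i j (λ s → w s * toℕ (x s)) t * (d * d)
      termwise t = begin
        windowTerm i j a x t                                        ≡⟨ windowTerm≡window i j a x t ⟩
        window i j (λ s → toℕ (a s) * toℕ (x s)) t                  ≡⟨ window-cong i j (rescale t) ⟩
        window i j (λ s → w s * toℕ (x s) * (d * d)) t              ≡⟨ window-map i j (_* (d * d)) refl _ t ⟩
        window i j (λ s → w s * toℕ (x s)) t * (d * d)              ∎
    finSum%n≡0 : finSum (windowTerm i j a x) % n ≡ 0
    finSum%n≡0 = n∣m⇒m%n≡0 _ n (subst₂ _∣_ (sym n≡q*d²) (sym finSum≡S*d²) (*-monoˡ-∣ (d * d) q∣S))

corollary9 : (n : ℕ) → .{{_ : NonZero n}} → (∃ λ m → n ≡ m * m) → 5 ^ 4 ∣ n → CLe n 7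
corollary9 n (m , n≡m²) 5⁴∣n =
  5 , s≤s z≤n , m≤m+n 5 2 , λ x → transfer 625 d n≡625*d² x (zeroSumWindow625 (toℕ ∘ x))
  where
  d = m / 25
  n≡625*d² : n ≡ 625 * (d * d)
  n≡625*d² = begin
    n                  ≡⟨ n≡m² ⟩
    m * m              ≡⟨ cong (λ r → r * r) (m/n*n≡m (625∣m²⇒25∣m m (subst (625 ∣_) n≡m² 5⁴∣n))) ⟨
    d * 25 * (d * 25)  ≡⟨ square-of-multiple d ⟩
    625 * (d * d)      ∎
    where
    square-of-multiple : ∀ d → d * 25 * (d * 25) ≡ 625 * (d * d)
    square-of-multiple = solve-∀
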